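{- Let $(S,\nabla)$ be a divergence Kleene algebra and let $a,b\in S$ be such that $a$ d-quasi-commutes over $b$, i.e. $|b\rangle|a\rangle\le |a\rangle\,|(a+b)^*\rangle$. Then $a+b$ is Noetherian if and only if $a$ and $b$ are both Noetherian; equivalently, $\nabla(a+b)\le 0 \iff \nabla a+\nabla b\le 0$.
   Context: An idempotent semiring is a structure $(S,+,\cdot,0,1)$ such that $(S,+,0)$ is a commutative monoid with $a+a=a$, $(S,\cdot,1)$ is a monoid, multiplication distributes over addition from both sides, and $0a=a0=0$. Its natural order is $a\le b\iff a+b=b$. A test is an element $p\le 1$ for which some $q$ satisfies $p+q=1$ and $pq=0=qp$; this $q$ is unique and written $\neg p$. The tests form a Boolean algebra $\mathrm{test}(S)$ (join $+$, meet $\cdot$, complement $\neg$); $p-q=p\cdot\neg q$. $S$ is a modal semiring if for each $a\in S$ there are maps $|a\rangle,\langle a|:\mathrm{test}(S)\to\mathrm{test}(S)$ with, for all $a,b,p,q$: $|a\rangle p\le q\iff \neg q\,a\,p\le 0$; $\langle a|p\le q\iff p\,a\,\neg q\le 0$; $|ab\rangle p=|a\rangle(|b\rangle p)$; $\langle ab|p=\langle b|(\langle a|p)$. Maps on tests are ordered pointwise and juxtaposition denotes composition. A Kleene algebra is an idempotent semiring with ${}^*$ satisfying $1+aa^*\le a^*$, $b+ac\le c\Rightarrow a^*b\le c$, $1+a^*a\le a^*$, $b+ca\le c\Rightarrow ba^*\le c$. An element $a$ is Noetherian if for all tests $p$, $p-|a\rangle p\le 0$ implies $p\le 0$. For $a$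 in a modal semiring, a test $\nabla a$ is the divergence of $a$ if $\nabla a\le|a\rangle\nabla a$ and for every test $p$, $p\le |a\rangle p\Rightarrow p\le \nabla a$. A divergence Kleene algebra is a Kleene algebra that is a modal semiring in which $\nabla a$ exists for every $a$. -}

module Defs where

open import Level using (Level; _⊔_; suc)
open import Algebra.Bundles using (IdempotentSemiring)
open import Data.Product using (Σ; _×_; proj₁; proj₂)
open import Function.Bundles using (_⇔_)

module _ {c ℓ : Level} (S : IdempotentSemiring c ℓ) where
  open IdempotentSemiring S

  _≤ₙ_ : Carrier → Carrier → Set ℓ
  x ≤ₙ y = (x + y) ≈ y

  record IsTest (p : Carrier) : Set (c ⊔ ℓ) where
    field
      ≤1    : p ≤ₙ 1#
      compl : Carrier
      join  : (p + compl) ≈ 1#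
      meetˡ : (p * compl) ≈ 0#
      meetʳ : (compl * p) ≈ 0#

  Test : Set (c ⊔ ℓ)
  Test = Σ Carrier IsTest

  ⌜_⌝ : Test → Carrier
  ⌜ t ⌝ = proj₁ t

  ¬ₜ : Test → Carrier
  ¬ₜ t = IsTest.compl (proj₂ t)

  _−ₜ_ : Test → Test → Carrier
  p −ₜ q = ⌜ p ⌝ * ¬ₜ q

  -- modal semiring: forward diamond |a⟩ = fd a, backward diamond ⟨a| = bd a
  record IsModal (fd bd : Carrier → Test → Test) : Set (c ⊔ ℓ) where
    field
      fd-adj : ∀ a (p q : Test) → (⌜ fd a p ⌝ ≤ₙ ⌜ q ⌝) ⇔ ((¬ₜ q * a * ⌜ p ⌝) ≤ₙ 0#)
      bd-adj : ∀ a (p q : Test) → (⌜ bd a p ⌝ ≤ₙ ⌜ q ⌝) ⇔ ((⌜ p ⌝ * a * ¬ₜ q) ≤ₙ 0#)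
      fd-comp : ∀ a b (p : Test) → ⌜ fd (a * b) p ⌝ ≈ ⌜ fd a (fd b p) ⌝
      bd-comp : ∀ a b (p : Test) → ⌜ bd (a * b) p ⌝ ≈ ⌜ bd b (bd a p) ⌝

  record IsKleeneStar (_⋆ : Carrier → Carrier) : Set (c ⊔ ℓ) where
    field
      unfoldˡ : ∀ a → (1# + a * (a ⋆)) ≤ₙ (a ⋆)
      inductˡ : ∀ a b x → (b + a * x) ≤ₙ x → ((a ⋆) * b) ≤ₙ x
      unfoldʳ : ∀ a → (1# + (a ⋆) * a) ≤ₙ (a ⋆)
      inductʳ : ∀ a b x → (b + x * a) ≤ₙ x → (b * (a ⋆)) ≤ₙ x

record DivergenceKleeneAlgebra (c ℓ : Level) : Set (suc (c ⊔ ℓ)) where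
  field
    idempotentSemiring : IdempotentSemiring c ℓ
  open IdempotentSemiring idempotentSemiring public
  field
    _⋆ : Carrier → Carrier
    isKleeneStar : IsKleeneStar idempotentSemiring _⋆
    fd : Carrier → Test idempotentSemiring → Test idempotentSemiring
    bd : Carrier → Test idempotentSemiring → Test idempotentSemiring
    isModal : IsModal idempotentSemiring fd bd
    ∇ : Carrier → Test idempotentSemiring
    ∇-unfold : ∀ a → _≤ₙ_ idempotentSemiring (⌜_⌝ idempotentSemiring (∇ a))
                 (⌜_⌝ idempotentSemiring (fd a (∇ a)))
    ∇-greatest : ∀ a (p : Test idempotentSemiring) →
                 _≤ₙ_ idempotentSemiring (⌜_⌝ idempotentSemiring p) (⌜_⌝ idempotentSemiring (fd a p)) →
                 _≤ₙ_ idempotentSemiring (⌜_⌝ idempotentSemiring p) (⌜_⌝ idempotentSemiring (∇ a))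

module DKA {c ℓ : Level} (D : DivergenceKleeneAlgebra c ℓ) where
  open DivergenceKleeneAlgebra D public

  _≤_ : Carrier → Carrier → Set ℓ
  _≤_ = _≤ₙ_ idempotentSemiring

  T : Set (c ⊔ ℓ)
  T = Test idempotentSemiring

  ∣_⟩ : Carrier → T → T
  ∣ a ⟩ = fd a

  ⟦_⟧ : T → Carrier
  ⟦ t ⟧ = ⌜_⌝ idempotentSemiring t

  Noetherian : Carrier → Set (c ⊔ ℓ)
  Noetherian a = ∀ (p : T) → (_−ₜ_ idempotentSemiring p (∣ a ⟩ p) ≤ 0#) → ⟦ p ⟧ ≤ 0#

  DQuasiCommutes : Carrier → Carrier → Set (c ⊔ ℓ)
  DQuasiCommutes a b = ∀ (p : T) → ⟦ ∣ b ⟩ (∣ a ⟩ p) ⟧ ≤ ⟦ ∣ a ⟩ (∣ (a + b) ⋆ ⟩ p) ⟧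

module Submission where

-- Write c = a + b and d = ∇c.  Since a, b ≤ c, divergence is monotone and
-- ∇a + ∇b ≤ ∇c, which gives the easy half of both equivalences.  For the hard
-- half assume ∇a = ∇b = 0.  Because ∇b = 0, every c-diverging state must
-- eventually perform an a-step:  d ≤ |b*a⟩d  (lemma diverging-reaches-a, shown
-- by proving that the test  d · ¬|b*a⟩d  is b-divergent).  Quasi-commutation
-- lifts to stars, |b*⟩|a⟩ ≤ |a⟩|c*⟩, and ∇c is closed under |c*⟩, so
-- d ≤ |b*⟩|a⟩d ≤ |a⟩|c*⟩d ≤ |a⟩d; hence d ≤ ∇a = 0.  Finally, a is Noetherian
-- exactly when ∇a ≤ 0, which turns the divergence equivalence into the
-- Noetherian one.

open import Defs
open import Level using (Level)
open import Algebra.Bundles using (IdempotentSemiring)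
open import Data.Product using (_×_; _,_; proj₂)
open import Data.Product.Function.NonDependent.Propositional using (_×-⇔_)
open import Function.Bundles using (_⇔_; mk⇔; Equivalence)
import Function.Properties.Equivalence as ⇔
open import Relation.Binary.Bundles using (Preorder)
import Relation.Binary.Reasoning.Preorder as PreorderReasoning

module NaturalOrder {c ℓ : Level} (S : IdempotentSemiring c ℓ) where
  open IdempotentSemiring S

  infix 4 _≤_
  _≤_ : Carrier → Carrier → Set ℓ
  _≤_ = _≤ₙ_ S

  ≤-reflexive : ∀ {x y} → x ≈ y → x ≤ y
  ≤-reflexive {x} {y} x≈y = trans (+-cong x≈y refl) (+-idem y)

  ≤-refl : ∀ {x} → x ≤ x
  ≤-refl = ≤-reflexive refl

  ≤-trans : ∀ {x y z} → x ≤ y → y ≤ z → x ≤ z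
  ≤-trans {x} {y} {z} x≤y y≤z =
    trans (+-cong refl (sym y≤z)) (trans (sym (+-assoc x y z)) (trans (+-cong x≤y refl) y≤z))

  ≤-antisym : ∀ {x y} → x ≤ y → y ≤ x → x ≈ y
  ≤-antisym {x} {y} x≤y y≤x = trans (sym y≤x) (trans (+-comm y x) x≤y)

  ≤-preorder : Preorder c ℓ ℓ
  ≤-preorder = record
    { Carrier = Carrier ; _≈_ = _≈_ ; _≲_ = _≤_
    ; isPreorder = record { isEquivalence = isEquivalence
                          ; reflexive = ≤-reflexive ; trans = ≤-trans } }

  module ≤-Reasoning = PreorderReasoning ≤-preorder

  x≤x+y : ∀ x y → x ≤ x + y
  x≤x+y x y = trans (sym (+-assoc x x y)) (+-cong (+-idem x) refl)

  y≤x+y : ∀ x y → y ≤ x + y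
  y≤x+y x y = ≤-trans (x≤x+y y x) (≤-reflexive (+-comm y x))

  +-lub : ∀ {x y z} → x ≤ z → y ≤ z → x + y ≤ z
  +-lub {x} {y} {z} x≤z y≤z = trans (+-assoc x y z) (trans (+-cong refl y≤z) x≤z)

  +-mono : ∀ {x x' y y'} → x ≤ x' → y ≤ y' → x + y ≤ x' + y'
  +-mono {x} {x'} {y} {y'} x≤x' y≤y' =
    +-lub (≤-trans x≤x' (x≤x+y x' y')) (≤-trans y≤y' (y≤x+y x' y'))

  +-lub⇔ : ∀ {x y z} → (x + y ≤ z) ⇔ ((x ≤ z) × (y ≤ z))
  +-lub⇔ {x} {y} = mk⇔ (λ h → ≤-trans (x≤x+y x y) h , ≤-trans (y≤x+y x y) h)
                       (λ (x≤z , y≤z) → +-lub x≤z y≤z)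

  *-monoˡ : ∀ z {x y} → x ≤ y → z * x ≤ z * y
  *-monoˡ z {x} {y} x≤y = trans (sym (distribˡ z x y)) (*-cong refl x≤y)

  *-monoʳ : ∀ z {x y} → x ≤ y → x * z ≤ y * z
  *-monoʳ z {x} {y} x≤y = trans (sym (distribʳ z x y)) (*-cong x≤y refl)

  ≤0⇒≈0 : ∀ {x} → x ≤ 0# → x ≈ 0#
  ≤0⇒≈0 {x} x≤0 = trans (sym (+-identityʳ x)) x≤0

  drop-≤0 : ∀ {x y} → y ≤ 0# → x + y ≈ x
  drop-≤0 {x} y≤0 = trans (+-cong refl (≤0⇒≈0 y≤0)) (+-identityʳ x)

module TestAlgebra {c ℓ : Level} (S : IdempotentSemiring c ℓ) where
  open IdempotentSemiring S
  open NaturalOrder S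
  open ≤-Reasoning

  ⟦_⟧ : Test S → Carrier
  ⟦_⟧ = ⌜_⌝ S

  ¬⟦_⟧ : Test S → Carrier
  ¬⟦_⟧ = ¬ₜ S

  test≤1 : ∀ t → ⟦ t ⟧ ≤ 1#
  test≤1 t = IsTest.≤1 (proj₂ t)

  test-join : ∀ t → ⟦ t ⟧ + ¬⟦ t ⟧ ≈ 1#
  test-join t = IsTest.join (proj₂ t)

  test-disjointˡ : ∀ t → ⟦ t ⟧ * ¬⟦ t ⟧ ≈ 0#
  test-disjointˡ t = IsTest.meetˡ (proj₂ t)

  test-disjointʳ : ∀ t → ¬⟦ t ⟧ * ⟦ t ⟧ ≈ 0#
  test-disjointʳ t = IsTest.meetʳ (proj₂ t)

  compl≤1 : ∀ t → ¬⟦ t ⟧ ≤ 1#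
  compl≤1 t = ≤-trans (y≤x+y ⟦ t ⟧ ¬⟦ t ⟧) (≤-reflexive (test-join t))

  ∁ : Test S → Test S
  ∁ t = ¬⟦ t ⟧ , record { ≤1 = compl≤1 t ; compl = ⟦ t ⟧
                        ; join = trans (+-comm _ _) (test-join t)
                        ; meetˡ = test-disjointʳ t ; meetʳ = test-disjointˡ t }

  splitʳ : ∀ x t → x ≈ x * ⟦ t ⟧ + x * ¬⟦ t ⟧
  splitʳ x t = trans (sym (*-identityʳ x)) (trans (*-cong refl (sym (test-join t))) (distribˡ x _ _))

  splitˡ : ∀ x t → x ≈ ⟦ t ⟧ * x + ¬⟦ t ⟧ * x
  splitˡ x t = trans (sym (*-identityˡ x)) (trans (*-cong (sym (test-join t)) refl) (distribʳ x _ _))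

  test-decʳ : ∀ x t → x * ⟦ t ⟧ ≤ x
  test-decʳ x t = ≤-trans (*-monoˡ x (test≤1 t)) (≤-reflexive (*-identityʳ x))

  test-decˡ : ∀ t x → ⟦ t ⟧ * x ≤ x
  test-decˡ t x = ≤-trans (*-monoʳ x (test≤1 t)) (≤-reflexive (*-identityˡ x))

  below-test-fixʳ : ∀ x t → x ≤ ⟦ t ⟧ → x ≈ x * ⟦ t ⟧
  below-test-fixʳ x t x≤t =
    trans (splitʳ x t) (drop-≤0 (≤-trans (*-monoʳ ¬⟦ t ⟧ x≤t) (≤-reflexive (test-disjointˡ t))))

  below-test-fixˡ : ∀ x t → x ≤ ⟦ t ⟧ → x ≈ ⟦ t ⟧ * x
  below-test-fixˡ x t x≤t =
    trans (splitˡ x t) (drop-≤0 (≤-trans (*-monoˡ ¬⟦ t ⟧ x≤t) (≤-reflexive (test-disjointʳ t))))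

  tests-commute : ∀ p q → ⟦ p ⟧ * ⟦ q ⟧ ≤ ⟦ q ⟧ * ⟦ p ⟧
  tests-commute p q = begin
    ⟦ p ⟧ * ⟦ q ⟧           ≈⟨ below-test-fixˡ _ q (test-decˡ p ⟦ q ⟧) ⟩
    ⟦ q ⟧ * (⟦ p ⟧ * ⟦ q ⟧) ≈⟨ *-assoc _ _ _ ⟨
    ⟦ q ⟧ * ⟦ p ⟧ * ⟦ q ⟧   ≲⟨ test-decʳ _ q ⟩
    ⟦ q ⟧ * ⟦ p ⟧           ∎

  test-≤-intro : ∀ p r → ⟦ p ⟧ * ¬⟦ r ⟧ ≤ 0# → ⟦ p ⟧ ≤ ⟦ r ⟧
  test-≤-intro p r p¬r≤0 = begin
    ⟦ p ⟧                             ≈⟨ splitʳ ⟦ p ⟧ r ⟩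
    ⟦ p ⟧ * ⟦ r ⟧ + ⟦ p ⟧ * ¬⟦ r ⟧   ≈⟨ drop-≤0 p¬r≤0 ⟩
    ⟦ p ⟧ * ⟦ r ⟧                     ≲⟨ test-decˡ p _ ⟩
    ⟦ r ⟧                             ∎

  test-≤-elim : ∀ p r → ⟦ p ⟧ ≤ ⟦ r ⟧ → ⟦ p ⟧ * ¬⟦ r ⟧ ≤ 0#
  test-≤-elim p r p≤r = ≤-trans (*-monoʳ ¬⟦ r ⟧ p≤r) (≤-reflexive (test-disjointˡ r))

  meet≤1 : ∀ p q → ⟦ p ⟧ * ⟦ q ⟧ ≤ 1#
  meet≤1 p q = ≤-trans (test-decˡ p _) (test≤1 q)

  meet-covers : ∀ p q → 1# ≤ ⟦ p ⟧ * ⟦ q ⟧ + (¬⟦ p ⟧ + ¬⟦ q ⟧)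
  meet-covers p q = begin
    1#                                          ≈⟨ test-join p ⟨
    ⟦ p ⟧ + ¬⟦ p ⟧                              ≈⟨ +-cong (splitʳ ⟦ p ⟧ q) refl ⟩
    ⟦ p ⟧ * ⟦ q ⟧ + ⟦ p ⟧ * ¬⟦ q ⟧ + ¬⟦ p ⟧    ≲⟨ +-mono (+-mono ≤-refl (test-decˡ p _)) ≤-refl ⟩
    ⟦ p ⟧ * ⟦ q ⟧ + ¬⟦ q ⟧ + ¬⟦ p ⟧            ≈⟨ +-assoc _ _ _ ⟩
    ⟦ p ⟧ * ⟦ q ⟧ + (¬⟦ q ⟧ + ¬⟦ p ⟧)          ≈⟨ +-cong refl (+-comm _ _) ⟩
    ⟦ p ⟧ * ⟦ q ⟧ + (¬⟦ p ⟧ + ¬⟦ q ⟧)          ∎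

  meet-disjointˡ : ∀ p q → ⟦ p ⟧ * ⟦ q ⟧ * (¬⟦ p ⟧ + ¬⟦ q ⟧) ≤ 0#
  meet-disjointˡ p q = begin
    ⟦ p ⟧ * ⟦ q ⟧ * (¬⟦ p ⟧ + ¬⟦ q ⟧)                   ≈⟨ distribˡ _ _ _ ⟩
    ⟦ p ⟧ * ⟦ q ⟧ * ¬⟦ p ⟧ + ⟦ p ⟧ * ⟦ q ⟧ * ¬⟦ q ⟧    ≲⟨ +-lub pq¬p≤0 pq¬q≤0 ⟩
    0#                                                    ∎
    where
    pq¬p≤0 : ⟦ p ⟧ * ⟦ q ⟧ * ¬⟦ p ⟧ ≤ 0#
    pq¬p≤0 = begin
      ⟦ p ⟧ * ⟦ q ⟧ * ¬⟦ p ⟧     ≈⟨ *-assoc _ _ _ ⟩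
      ⟦ p ⟧ * (⟦ q ⟧ * ¬⟦ p ⟧)   ≲⟨ *-monoˡ ⟦ p ⟧ (tests-commute q (∁ p)) ⟩
      ⟦ p ⟧ * (¬⟦ p ⟧ * ⟦ q ⟧)   ≈⟨ *-assoc _ _ _ ⟨
      ⟦ p ⟧ * ¬⟦ p ⟧ * ⟦ q ⟧     ≈⟨ *-cong (test-disjointˡ p) refl ⟩
      0# * ⟦ q ⟧                  ≈⟨ zeroˡ _ ⟩
      0#                          ∎
    pq¬q≤0 : ⟦ p ⟧ * ⟦ q ⟧ * ¬⟦ q ⟧ ≤ 0#
    pq¬q≤0 = ≤-reflexive (begin-equality
      ⟦ p ⟧ * ⟦ q ⟧ * ¬⟦ q ⟧     ≈⟨ *-assoc _ _ _ ⟩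
      ⟦ p ⟧ * (⟦ q ⟧ * ¬⟦ q ⟧)   ≈⟨ *-cong refl (test-disjointˡ q) ⟩
      ⟦ p ⟧ * 0#                  ≈⟨ zeroʳ _ ⟩
      0#                          ∎)

  meet-disjointʳ : ∀ p q → (¬⟦ p ⟧ + ¬⟦ q ⟧) * (⟦ p ⟧ * ⟦ q ⟧) ≤ 0#
  meet-disjointʳ p q = begin
    (¬⟦ p ⟧ + ¬⟦ q ⟧) * (⟦ p ⟧ * ⟦ q ⟧)                   ≈⟨ distribʳ _ _ _ ⟩
    ¬⟦ p ⟧ * (⟦ p ⟧ * ⟦ q ⟧) + ¬⟦ q ⟧ * (⟦ p ⟧ * ⟦ q ⟧)  ≲⟨ +-lub ¬ppq≤0 ¬qpq≤0 ⟩
    0#                                                      ∎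
    where
    ¬ppq≤0 : ¬⟦ p ⟧ * (⟦ p ⟧ * ⟦ q ⟧) ≤ 0#
    ¬ppq≤0 = ≤-reflexive (begin-equality
      ¬⟦ p ⟧ * (⟦ p ⟧ * ⟦ q ⟧)   ≈⟨ *-assoc _ _ _ ⟨
      ¬⟦ p ⟧ * ⟦ p ⟧ * ⟦ q ⟧     ≈⟨ *-cong (test-disjointʳ p) refl ⟩
      0# * ⟦ q ⟧                  ≈⟨ zeroˡ _ ⟩
      0#                          ∎)
    ¬qpq≤0 : ¬⟦ q ⟧ * (⟦ p ⟧ * ⟦ q ⟧) ≤ 0#
    ¬qpq≤0 = begin
      ¬⟦ q ⟧ * (⟦ p ⟧ * ⟦ q ⟧)   ≈⟨ *-assoc _ _ _ ⟨
      ¬⟦ q ⟧ * ⟦ p ⟧ * ⟦ q ⟧     ≲⟨ *-monoʳ ⟦ q ⟧ (tests-commute (∁ q) p) ⟩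
      ⟦ p ⟧ * ¬⟦ q ⟧ * ⟦ q ⟧     ≈⟨ *-assoc _ _ _ ⟩
      ⟦ p ⟧ * (¬⟦ q ⟧ * ⟦ q ⟧)   ≈⟨ *-cong refl (test-disjointʳ q) ⟩
      ⟦ p ⟧ * 0#                  ≈⟨ zeroʳ _ ⟩
      0#                          ∎

  infixl 7 _⊓_
  _⊓_ : Test S → Test S → Test S
  p ⊓ q = ⟦ p ⟧ * ⟦ q ⟧ , record
    { ≤1 = meet≤1 p q
    ; compl = ¬⟦ p ⟧ + ¬⟦ q ⟧
    ; join = ≤-antisym (+-lub (meet≤1 p q) (+-lub (compl≤1 p) (compl≤1 q))) (meet-covers p q)
    ; meetˡ = ≤0⇒≈0 (meet-disjointˡ p q)
    ; meetʳ = ≤0⇒≈0 (meet-disjointʳ p q)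
    }

module Diamonds {c ℓ : Level} (S : IdempotentSemiring c ℓ)
                {fd bd : IdempotentSemiring.Carrier S → Test S → Test S}
                (modal : IsModal S fd bd) where
  open IdempotentSemiring S
  open NaturalOrder S
  open TestAlgebra S
  open IsModal modal using (fd-adj)
  open IsModal modal public using () renaming (fd-comp to ∣⟩-compose)
  open ≤-Reasoning

  ∣_⟩ : Carrier → Test S → Test S
  ∣_⟩ = fd

  ∣⟩-adj⇒ : ∀ x p q → ⟦ ∣ x ⟩ p ⟧ ≤ ⟦ q ⟧ → ¬⟦ q ⟧ * x * ⟦ p ⟧ ≤ 0#
  ∣⟩-adj⇒ x p q = Equivalence.to (fd-adj x p q)

  ∣⟩-adj⇐ : ∀ x p q → ¬⟦ q ⟧ * x * ⟦ p ⟧ ≤ 0# → ⟦ ∣ x ⟩ p ⟧ ≤ ⟦ q ⟧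
  ∣⟩-adj⇐ x p q = Equivalence.from (fd-adj x p q)

  ∣⟩-unit : ∀ x p → ¬⟦ ∣ x ⟩ p ⟧ * x * ⟦ p ⟧ ≤ 0#
  ∣⟩-unit x p = ∣⟩-adj⇒ x p (∣ x ⟩ p) ≤-refl

  ∣⟩-mono-test : ∀ x {p q} → ⟦ p ⟧ ≤ ⟦ q ⟧ → ⟦ ∣ x ⟩ p ⟧ ≤ ⟦ ∣ x ⟩ q ⟧
  ∣⟩-mono-test x {p} {q} p≤q =
    ∣⟩-adj⇐ x p (∣ x ⟩ q) (≤-trans (*-monoˡ (¬⟦ ∣ x ⟩ q ⟧ * x) p≤q) (∣⟩-unit x q))

  ∣⟩-mono-elem : ∀ {x y} p → x ≤ y → ⟦ ∣ x ⟩ p ⟧ ≤ ⟦ ∣ y ⟩ p ⟧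
  ∣⟩-mono-elem {x} {y} p x≤y =
    ∣⟩-adj⇐ x p (∣ y ⟩ p) (≤-trans (*-monoʳ ⟦ p ⟧ (*-monoˡ ¬⟦ ∣ y ⟩ p ⟧ x≤y)) (∣⟩-unit y p))

  ∣⟩-+-lub : ∀ x y p q → ⟦ ∣ x ⟩ p ⟧ ≤ ⟦ q ⟧ → ⟦ ∣ y ⟩ p ⟧ ≤ ⟦ q ⟧ → ⟦ ∣ x + y ⟩ p ⟧ ≤ ⟦ q ⟧
  ∣⟩-+-lub x y p q xp≤q yp≤q = ∣⟩-adj⇐ (x + y) p q (begin
    ¬⟦ q ⟧ * (x + y) * ⟦ p ⟧                     ≈⟨ *-cong (distribˡ _ _ _) refl ⟩
    (¬⟦ q ⟧ * x + ¬⟦ q ⟧ * y) * ⟦ p ⟧            ≈⟨ distribʳ _ _ _ ⟩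
    ¬⟦ q ⟧ * x * ⟦ p ⟧ + ¬⟦ q ⟧ * y * ⟦ p ⟧     ≲⟨ +-lub (∣⟩-adj⇒ x p q xp≤q) (∣⟩-adj⇒ y p q yp≤q) ⟩
    0#                                            ∎)

  ∣1⟩-≤ : ∀ p → ⟦ ∣ 1# ⟩ p ⟧ ≤ ⟦ p ⟧
  ∣1⟩-≤ p = ∣⟩-adj⇐ 1# p p (≤-reflexive (trans (*-cong (*-identityʳ _) refl) (test-disjointʳ p)))

  ∣⟩-expansive : ∀ x p → 1# ≤ x → ⟦ p ⟧ ≤ ⟦ ∣ x ⟩ p ⟧
  ∣⟩-expansive x p 1≤x = test-≤-intro p (∣ x ⟩ p) (begin
    ⟦ p ⟧ * ¬⟦ r ⟧       ≲⟨ tests-commute p (∁ r) ⟩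
    ¬⟦ r ⟧ * ⟦ p ⟧       ≈⟨ *-cong (*-identityʳ ¬⟦ r ⟧) refl ⟨
    ¬⟦ r ⟧ * 1# * ⟦ p ⟧  ≲⟨ *-monoʳ ⟦ p ⟧ (*-monoˡ ¬⟦ r ⟧ 1≤x) ⟩
    ¬⟦ r ⟧ * x * ⟦ p ⟧   ≲⟨ ∣⟩-unit x p ⟩
    0#                   ∎)
    where r = ∣ x ⟩ p

  ∣⟩-disjoint⇒ : ∀ s x p → ⟦ s ⟧ * ⟦ ∣ x ⟩ p ⟧ ≤ 0# → ⟦ s ⟧ * x * ⟦ p ⟧ ≤ 0#
  ∣⟩-disjoint⇒ s x p s⊥xp = ∣⟩-adj⇒ x p (∁ s)
    (test-≤-intro (∣ x ⟩ p) (∁ s) (≤-trans (tests-commute (∣ x ⟩ p) s) s⊥xp))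

  ∣⟩-disjoint⇐ : ∀ s x p → ⟦ s ⟧ * x * ⟦ p ⟧ ≤ 0# → ⟦ s ⟧ * ⟦ ∣ x ⟩ p ⟧ ≤ 0#
  ∣⟩-disjoint⇐ s x p sxp≤0 =
    ≤-trans (*-monoˡ ⟦ s ⟧ (∣⟩-adj⇐ x p (∁ s) sxp≤0)) (≤-reflexive (test-disjointˡ s))

  ∣⟩-closed-commutes : ∀ x r → ⟦ ∣ x ⟩ r ⟧ ≤ ⟦ r ⟧ → x * ⟦ r ⟧ ≤ ⟦ r ⟧ * x
  ∣⟩-closed-commutes x r xr≤r = begin
    x * ⟦ r ⟧                                          ≈⟨ splitˡ (x * ⟦ r ⟧) r ⟩
    ⟦ r ⟧ * (x * ⟦ r ⟧) + ¬⟦ r ⟧ * (x * ⟦ r ⟧)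
      ≈⟨ drop-≤0 (≤-trans (≤-reflexive (sym (*-assoc _ _ _))) (∣⟩-adj⇒ x r r xr≤r)) ⟩
    ⟦ r ⟧ * (x * ⟦ r ⟧)                                ≈⟨ *-assoc _ _ _ ⟨
    ⟦ r ⟧ * x * ⟦ r ⟧                                  ≲⟨ test-decʳ _ r ⟩
    ⟦ r ⟧ * x                                          ∎

module StarProperties {c ℓ : Level} (S : IdempotentSemiring c ℓ)
                      {_⋆ : IdempotentSemiring.Carrier S → IdempotentSemiring.Carrier S}
                      (kleene : IsKleeneStar S _⋆) where
  open IdempotentSemiring S
  open NaturalOrder S
  open IsKleeneStar kleene
  open ≤-Reasoning

  1≤x⋆ : ∀ x → 1# ≤ x ⋆
  1≤x⋆ x = ≤-trans (x≤x+y _ _) (unfoldˡ x)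

  xx⋆≤x⋆ : ∀ x → x * x ⋆ ≤ x ⋆
  xx⋆≤x⋆ x = ≤-trans (y≤x+y _ _) (unfoldˡ x)

  x⋆x⋆≤x⋆ : ∀ x → x ⋆ * x ⋆ ≤ x ⋆
  x⋆x⋆≤x⋆ x = inductˡ x (x ⋆) (x ⋆) (+-lub ≤-refl (xx⋆≤x⋆ x))

  x⋆≤1+xx⋆ : ∀ x → x ⋆ ≤ 1# + x * x ⋆
  x⋆≤1+xx⋆ x = ≤-trans (≤-reflexive (sym (*-identityʳ (x ⋆))))
    (inductˡ x 1# (1# + x * x ⋆)
      (+-mono ≤-refl (*-monoˡ x (+-lub (1≤x⋆ x) (xx⋆≤x⋆ x)))))

  ⋆-simulation : ∀ x r → x * r ≤ r * x → x ⋆ * r ≤ r * x ⋆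
  ⋆-simulation x r xr≤rx = inductˡ x r (r * x ⋆) (+-lub
    (≤-trans (≤-reflexive (sym (*-identityʳ r))) (*-monoˡ r (1≤x⋆ x)))
    (begin
      x * (r * x ⋆)   ≈⟨ *-assoc _ _ _ ⟨
      x * r * x ⋆     ≲⟨ *-monoʳ (x ⋆) xr≤rx ⟩
      r * x * x ⋆     ≈⟨ *-assoc _ _ _ ⟩
      r * (x * x ⋆)   ≲⟨ *-monoˡ r (xx⋆≤x⋆ x) ⟩
      r * x ⋆         ∎))

module StarDiamonds {c ℓ : Level} (S : IdempotentSemiring c ℓ)
                    {fd bd : IdempotentSemiring.Carrier S → Test S → Test S}
                    (modal : IsModal S fd bd)
                    {_⋆ : IdempotentSemiring.Carrier S → IdempotentSemiring.Carrier S}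
                    (kleene : IsKleeneStar S _⋆) where
  open IdempotentSemiring S
  open NaturalOrder S
  open TestAlgebra S
  open Diamonds S modal
  open StarProperties S kleene
  open ≤-Reasoning

  ∣⋆⟩-expansive : ∀ x p → ⟦ p ⟧ ≤ ⟦ ∣ x ⋆ ⟩ p ⟧
  ∣⋆⟩-expansive x p = ∣⟩-expansive (x ⋆) p (1≤x⋆ x)

  ∣⋆⟩-closed : ∀ x r → ⟦ ∣ x ⟩ r ⟧ ≤ ⟦ r ⟧ → ⟦ ∣ x ⋆ ⟩ r ⟧ ≤ ⟦ r ⟧
  ∣⋆⟩-closed x r xr≤r = ∣⟩-adj⇐ (x ⋆) r r (begin
    ¬⟦ r ⟧ * x ⋆ * ⟦ r ⟧      ≈⟨ *-assoc _ _ _ ⟩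
    ¬⟦ r ⟧ * (x ⋆ * ⟦ r ⟧)    ≲⟨ *-monoˡ ¬⟦ r ⟧ (⋆-simulation x ⟦ r ⟧ (∣⟩-closed-commutes x r xr≤r)) ⟩
    ¬⟦ r ⟧ * (⟦ r ⟧ * x ⋆)    ≈⟨ *-assoc _ _ _ ⟨
    ¬⟦ r ⟧ * ⟦ r ⟧ * x ⋆      ≈⟨ *-cong (test-disjointʳ r) refl ⟩
    0# * x ⋆                   ≈⟨ zeroˡ _ ⟩
    0#                         ∎)

  ∣⋆⟩-induction : ∀ x u r → ⟦ u ⟧ ≤ ⟦ r ⟧ → ⟦ ∣ x ⟩ r ⟧ ≤ ⟦ r ⟧ → ⟦ ∣ x ⋆ ⟩ u ⟧ ≤ ⟦ r ⟧
  ∣⋆⟩-induction x u r u≤r xr≤r = ≤-trans (∣⟩-mono-test (x ⋆) u≤r) (∣⋆⟩-closed x r xr≤r)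

  ∣⋆⟩-unfold-lub : ∀ x p q → ⟦ p ⟧ ≤ ⟦ q ⟧ → ⟦ ∣ x ⟩ (∣ x ⋆ ⟩ p) ⟧ ≤ ⟦ q ⟧ → ⟦ ∣ x ⋆ ⟩ p ⟧ ≤ ⟦ q ⟧
  ∣⋆⟩-unfold-lub x p q p≤q xx⋆p≤q = ≤-trans (∣⟩-mono-elem p (x⋆≤1+xx⋆ x))
    (∣⟩-+-lub 1# (x * x ⋆) p q (≤-trans (∣1⟩-≤ p) p≤q)
                              (≤-trans (≤-reflexive (∣⟩-compose x (x ⋆) p)) xx⋆p≤q))

  ∣⋆⟩-transitive : ∀ x p → ⟦ ∣ x ⋆ ⟩ (∣ x ⋆ ⟩ p) ⟧ ≤ ⟦ ∣ x ⋆ ⟩ p ⟧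
  ∣⋆⟩-transitive x p =
    ≤-trans (≤-reflexive (sym (∣⟩-compose (x ⋆) (x ⋆) p))) (∣⟩-mono-elem p (x⋆x⋆≤x⋆ x))

module Divergence {c ℓ : Level} (D : DivergenceKleeneAlgebra c ℓ) where
  -- the order of NaturalOrder is the same relation, with the usual precedence
  open DKA D hiding (_≤_)
  open NaturalOrder idempotentSemiring
  open TestAlgebra idempotentSemiring hiding (⟦_⟧)
  open Diamonds idempotentSemiring isModal hiding (∣_⟩)
  open StarProperties idempotentSemiring isKleeneStar
  open StarDiamonds idempotentSemiring isModal isKleeneStar
  open ≤-Reasoning

  noetherian⇔∇≤0 : ∀ x → Noetherian x ⇔ (⟦ ∇ x ⟧ ≤ 0#)
  noetherian⇔∇≤0 x = mk⇔
    (λ noeth → noeth (∇ x) (test-≤-elim (∇ x) (∣ x ⟩ (∇ x)) (∇-unfold x)))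
    (λ ∇x≤0 p p≤xp → ≤-trans (∇-greatest x p (test-≤-intro p (∣ x ⟩ p) p≤xp)) ∇x≤0)

  ∇-mono : ∀ {x y} → x ≤ y → ⟦ ∇ x ⟧ ≤ ⟦ ∇ y ⟧
  ∇-mono {x} {y} x≤y = ∇-greatest y (∇ x) (≤-trans (∇-unfold x) (∣⟩-mono-elem (∇ x) x≤y))

  ∇-⋆-closed : ∀ x → ⟦ ∣ x ⋆ ⟩ (∇ x) ⟧ ≤ ⟦ ∇ x ⟧
  ∇-⋆-closed x = ∇-greatest x p
    (∣⋆⟩-unfold-lub x (∇ x) (∣ x ⟩ p)
      (≤-trans (∇-unfold x) (∣⟩-mono-test x (∣⋆⟩-expansive x (∇ x)))) ≤-refl)
    where p = ∣ x ⋆ ⟩ (∇ x)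

  -- If b does not diverge, then from every state of a test d with d ≤ |a+b⟩d an
  -- a-step is reachable after finitely many b-steps.  Proof: the part q of d
  -- where this fails satisfies q ≤ |b⟩q, because its part s outside |b⟩q is
  -- empty; hence q ≤ ∇b = 0.
  diverging-reaches-a : ∀ a b d → ⟦ d ⟧ ≤ ⟦ ∣ a + b ⟩ d ⟧ → ⟦ ∇ b ⟧ ≤ 0# →
                        ⟦ d ⟧ ≤ ⟦ ∣ b ⋆ * a ⟩ d ⟧
  diverging-reaches-a a b d d≤cd ∇b≤0 = test-≤-intro d e q≤0
    where
    e q s : T
    e = ∣ b ⋆ * a ⟩ d
    q = d ⊓ ∁ e
    s = q ⊓ ∁ (∣ b ⟩ q)

    e-b-closed : ⟦ ∣ b ⟩ e ⟧ ≤ ⟦ e ⟧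
    e-b-closed = ≤-trans (≤-reflexive (sym (∣⟩-compose b (b ⋆ * a) d)))
      (∣⟩-mono-elem d (≤-trans (≤-reflexive (sym (*-assoc _ _ _))) (*-monoʳ a (xx⋆≤x⋆ b))))

    s⊥e : ⟦ s ⟧ * ⟦ e ⟧ ≤ 0#
    s⊥e = ≤-trans (*-monoʳ ⟦ e ⟧ (≤-trans (test-decʳ ⟦ q ⟧ (∁ (∣ b ⟩ q))) (test-decˡ d _)))
                  (≤-reflexive (test-disjointʳ e))

    s⊥bq : ⟦ s ⟧ * ⟦ ∣ b ⟩ q ⟧ ≤ 0#
    s⊥bq = ≤-trans (*-monoʳ _ (test-decˡ q _)) (≤-reflexive (test-disjointʳ (∣ b ⟩ q)))

    s-a-d : ⟦ s ⟧ * a * ⟦ d ⟧ ≤ 0#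
    s-a-d = ≤-trans (*-monoʳ ⟦ d ⟧ (*-monoˡ ⟦ s ⟧ a≤b⋆a)) (∣⟩-disjoint⇒ s (b ⋆ * a) d s⊥e)
      where
      a≤b⋆a : a ≤ b ⋆ * a
      a≤b⋆a = ≤-trans (≤-reflexive (sym (*-identityˡ a))) (*-monoʳ a (1≤x⋆ b))

    -- split d into d·e and q = d·¬e
    s-b-d : ⟦ s ⟧ * b * ⟦ d ⟧ ≤ 0#
    s-b-d = begin
      ⟦ s ⟧ * b * ⟦ d ⟧                                    ≈⟨ *-cong refl (splitʳ ⟦ d ⟧ e) ⟩
      ⟦ s ⟧ * b * (⟦ d ⟧ * ⟦ e ⟧ + ⟦ q ⟧)                 ≈⟨ distribˡ _ _ _ ⟩
      ⟦ s ⟧ * b * (⟦ d ⟧ * ⟦ e ⟧) + ⟦ s ⟧ * b * ⟦ q ⟧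
        ≲⟨ +-lub (≤-trans (*-monoˡ _ (test-decˡ d _))
                          (∣⟩-disjoint⇒ s b e (≤-trans (*-monoˡ ⟦ s ⟧ e-b-closed) s⊥e)))
                 (∣⟩-disjoint⇒ s b q s⊥bq) ⟩
      0#                                                    ∎

    s-c-d : ⟦ s ⟧ * (a + b) * ⟦ d ⟧ ≤ 0#
    s-c-d = begin
      ⟦ s ⟧ * (a + b) * ⟦ d ⟧                   ≈⟨ *-cong (distribˡ _ _ _) refl ⟩
      (⟦ s ⟧ * a + ⟦ s ⟧ * b) * ⟦ d ⟧          ≈⟨ distribʳ _ _ _ ⟩
      ⟦ s ⟧ * a * ⟦ d ⟧ + ⟦ s ⟧ * b * ⟦ d ⟧   ≲⟨ +-lub s-a-d s-b-d ⟩
      0#                                         ∎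

    s≤0 : ⟦ s ⟧ ≤ 0#
    s≤0 = begin
      ⟦ s ⟧                       ≈⟨ below-test-fixʳ ⟦ s ⟧ (∣ a + b ⟩ d) (≤-trans s≤d d≤cd) ⟩
      ⟦ s ⟧ * ⟦ ∣ a + b ⟩ d ⟧    ≲⟨ ∣⟩-disjoint⇐ s (a + b) d s-c-d ⟩
      0#                          ∎
      where
      s≤d : ⟦ s ⟧ ≤ ⟦ d ⟧
      s≤d = ≤-trans (test-decʳ _ (∁ (∣ b ⟩ q))) (test-decʳ _ (∁ e))

    q≤0 : ⟦ q ⟧ ≤ 0#
    q≤0 = ≤-trans (∇-greatest b q (test-≤-intro q (∣ b ⟩ q) s≤0)) ∇b≤0

  ⋆-quasi-commutation : ∀ a b → DQuasiCommutes a b →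
                        ∀ p → ⟦ ∣ b ⋆ ⟩ (∣ a ⟩ p) ⟧ ≤ ⟦ ∣ a ⟩ (∣ (a + b) ⋆ ⟩ p) ⟧
  ⋆-quasi-commutation a b quasi p = ∣⋆⟩-induction b (∣ a ⟩ p) r
    (∣⟩-mono-test a (∣⋆⟩-expansive (a + b) p))
    (≤-trans (quasi (∣ (a + b) ⋆ ⟩ p)) (∣⟩-mono-test a (∣⋆⟩-transitive (a + b) p)))
    where r = ∣ a ⟩ (∣ (a + b) ⋆ ⟩ p)

  ∇-sum-vanishes : ∀ a b → DQuasiCommutes a b → ⟦ ∇ a ⟧ ≤ 0# → ⟦ ∇ b ⟧ ≤ 0# →
                   ⟦ ∇ (a + b) ⟧ ≤ 0#
  ∇-sum-vanishes a b quasi ∇a≤0 ∇b≤0 = ≤-trans (∇-greatest a d d≤ad) ∇a≤0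
    where
    d : T
    d = ∇ (a + b)
    d≤ad : ⟦ d ⟧ ≤ ⟦ ∣ a ⟩ d ⟧
    d≤ad = begin
      ⟦ d ⟧                               ≲⟨ diverging-reaches-a a b d (∇-unfold (a + b)) ∇b≤0 ⟩
      ⟦ ∣ b ⋆ * a ⟩ d ⟧                   ≈⟨ ∣⟩-compose (b ⋆) a d ⟩
      ⟦ ∣ b ⋆ ⟩ (∣ a ⟩ d) ⟧              ≲⟨ ⋆-quasi-commutation a b quasi d ⟩
      ⟦ ∣ a ⟩ (∣ (a + b) ⋆ ⟩ d) ⟧        ≲⟨ ∣⟩-mono-test a (∇-⋆-closed (a + b)) ⟩
      ⟦ ∣ a ⟩ d ⟧                         ∎

theorem10p6 : ∀ {c ℓ : Level} (D : DivergenceKleeneAlgebra c ℓ) → let open DKA D in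
    (a b : Carrier) → DQuasiCommutes a b →
    (Noetherian (a + b) ⇔ (Noetherian a × Noetherian b))
    × ((⟦ ∇ (a + b) ⟧ ≤ 0#) ⇔ ((⟦ ∇ a ⟧ + ⟦ ∇ b ⟧) ≤ 0#))
theorem10p6 D a b quasi = noetherian-sum , ∇-sum
  where
  open DKA D
  open NaturalOrder idempotentSemiring using (+-lub⇔; ≤-trans; x≤x+y; y≤x+y)
  open Divergence D

  ∇-sum : (⟦ ∇ (a + b) ⟧ ≤ 0#) ⇔ ((⟦ ∇ a ⟧ + ⟦ ∇ b ⟧) ≤ 0#)
  ∇-sum = mk⇔
    (λ ∇c≤0 → Equivalence.from +-lub⇔ ( ≤-trans (∇-mono (x≤x+y a b)) ∇c≤0
                                       , ≤-trans (∇-mono (y≤x+y a b)) ∇c≤0))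
    (λ ∇a+∇b≤0 → let (∇a≤0 , ∇b≤0) = Equivalence.to +-lub⇔ ∇a+∇b≤0
                 in ∇-sum-vanishes a b quasi ∇a≤0 ∇b≤0)

  noetherian-sum : Noetherian (a + b) ⇔ (Noetherian a × Noetherian b)
  noetherian-sum = ⇔.trans (noetherian⇔∇≤0 (a + b)) (⇔.trans ∇-sum
    (⇔.trans +-lub⇔ (⇔.sym (noetherian⇔∇≤0 a ×-⇔ noetherian⇔∇≤0 b))))
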